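{- Let $k$ be a field, $\beta \in k \setminus \{0\}$, and $A \subset k$ finite. Consider the automaton $\mathcal{A}$ with alphabet $A \times A$, set of states $k$, unique initial state $0$, unique final state $0$, and a transition $p \xrightarrow{(g,h)} q$ if and only if $q = \beta p + g - h$. Then an element $x \in k$ is a state of the trim of $\mathcal{A}$ (i.e. there is a path in $\mathcal{A}$ from $0$ to $x$ and a path from $x$ to $0$) if and only if there exist polynomials $P, Q$ with coefficients in $A - A = \{a-b : a,b\in A\}$ such that $x = P(\beta) = \beta^{ -1} Q(\beta^{ -1})$. -}

module Defs where

open import Level using (Level; _⊔_) renaming (suc to lsuc)
open import Algebra.Bundles using (CommutativeRing)
open import Data.Product using (Σ; ∃; _×_; _,_)
open import Data.List using (List; []; _∷_)
open import Relation.Nullary using (¬_)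
import Data.List.Membership.Setoid as SetoidMembership

record Field (c ℓ : Level) : Set (lsuc (c ⊔ ℓ)) where
  field
    commutativeRing : CommutativeRing c ℓ
  open CommutativeRing commutativeRing public
  field
    1≉0     : ¬ (1# ≈ 0#)
    inverse : ∀ x → ¬ (x ≈ 0#) → ∃ λ y → x * y ≈ 1#

module FieldAutomaton {c ℓ : Level} (K : Field c ℓ) where
  open Field K
  open SetoidMembership setoid public using (_∈_)

  data Path (β : Carrier) (A : List Carrier) : Carrier → Carrier → Set (c ⊔ ℓ) where
    done : ∀ {p r} → p ≈ r → Path β A p r
    step : ∀ {p q r} (g h : Carrier) → g ∈ A → h ∈ A →
           q ≈ β * p + g - h → Path β A q r → Path β A p r

  TrimState : (β : Carrier) (A : List Carrier) (x : Carrier) → Set (c ⊔ ℓ)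
  TrimState β A x = Path β A 0# x × Path β A x 0#

  InDiff : (A : List Carrier) (d : Carrier) → Set (c ⊔ ℓ)
  InDiff A d = Σ Carrier λ a → Σ Carrier λ b → a ∈ A × b ∈ A × d ≈ a - b

  -- polynomials as coefficient lists [c₀, c₁, …]; evaluation ∑ cᵢ tⁱ (Horner)
  eval : List Carrier → Carrier → Carrier
  eval []       t = 0#
  eval (d ∷ ds) t = d + t * eval ds t

  data CoeffsIn (A : List Carrier) : List Carrier → Set (c ⊔ ℓ) where
    []  : CoeffsIn A []
    _∷_ : ∀ {d ds} → InDiff A d → CoeffsIn A ds → CoeffsIn A (d ∷ ds)

-- A transition p ⟶ β p + (g - h) is one Horner step with digit g - h, so the
-- states reachable from 0 are exactly the values P(β) with coefficients in
-- A - A.  Run backwards and rescaled by β, a transition of 𝒜_β becomes a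
-- transition of 𝒜_{β⁻¹} with the digit pair swapped: p = β⁻¹ q + (h - g)
-- turns into β p = β⁻¹ (β q) + (h - g).  Hence x reaches 0 in 𝒜_β iff β x is
-- reachable from 0 in 𝒜_{β⁻¹}, i.e. iff β x = Q(β⁻¹).
module Submission where

open import Defs
open import Level using (Level)
open import Data.List using (List; []; _∷_)
open import Data.Product using (Σ; _×_; _,_)
open import Relation.Nullary using (¬_)
open import Function.Bundles using (_⇔_; mk⇔; module Equivalence)
import Algebra.Properties.Group as GroupProperties
import Relation.Binary.Reasoning.Setoid as SetoidReasoning

module TrimStates {c ℓ : Level} (K : Field c ℓ) where
  open Field K
  open FieldAutomaton K
  open GroupProperties +-group using (//-rightDividesˡ; //-rightDividesʳ)
  open SetoidReasoning setoid

  x+y-z≈y-z+x : ∀ x y z → x + y - z ≈ (y - z) + x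
  x+y-z≈y-z+x x y z = trans (+-assoc x y (- z)) (+-comm x (y - z))

  x+y-z+z-y≈x : ∀ x y z → x + y - z + z - y ≈ x
  x+y-z+z-y≈x x y z =
    trans (+-congʳ (//-rightDividesˡ z (x + y))) (//-rightDividesʳ y x)

  *-cancelˡ-inverse : ∀ {β γ} → γ * β ≈ 1# → ∀ x → γ * (β * x) ≈ x
  *-cancelˡ-inverse {β} {γ} γβ≈1 x = begin
    γ * (β * x)  ≈⟨ *-assoc γ β x ⟨
    (γ * β) * x  ≈⟨ *-congʳ γβ≈1 ⟩
    1# * x       ≈⟨ *-identityˡ x ⟩
    x            ∎

  module _ {β : Carrier} {A : List Carrier} where

    Path-resp : ∀ {p p′ r r′} → p′ ≈ p → r ≈ r′ → Path β A p r → Path β A p′ r′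
    Path-resp p′≈p r≈r′ (done p≈r) = done (trans p′≈p (trans p≈r r≈r′))
    Path-resp p′≈p r≈r′ (step g h g∈A h∈A q≈βp+g-h path) =
      step g h g∈A h∈A (trans q≈βp+g-h (+-congʳ (+-congʳ (*-congˡ (sym p′≈p)))))
        (Path-resp refl r≈r′ path)

    edge : ∀ {p q} (g h : Carrier) → g ∈ A → h ∈ A → q ≈ β * p + g - h → Path β A p q
    edge g h g∈A h∈A q≈βp+g-h = step g h g∈A h∈A q≈βp+g-h (done refl)

    _++_ : ∀ {p q r} → Path β A p q → Path β A q r → Path β A p r
    done p≈q ++ path′ = Path-resp p≈q refl path′
    step g h g∈A h∈A e path ++ path′ = step g h g∈A h∈A e (path ++ path′)

    reachable⇒eval : ∀ {p r P} → Path β A p r → CoeffsIn A P → p ≈ eval P β →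
                     Σ (List Carrier) λ P′ → CoeffsIn A P′ × r ≈ eval P′ β
    reachable⇒eval {P = P} (done p≈r) P∈ p≈Pβ = P , P∈ , trans (sym p≈r) p≈Pβ
    reachable⇒eval {p = p} (step g h g∈A h∈A q≈βp+g-h path) P∈ p≈Pβ =
      reachable⇒eval path ((g , h , g∈A , h∈A , refl) ∷ P∈)
        (trans q≈βp+g-h (trans (x+y-z≈y-z+x (β * p) g h) (+-congˡ (*-congˡ p≈Pβ))))

    eval⇒reachable : ∀ {P} → CoeffsIn A P → Path β A 0# (eval P β)
    eval⇒reachable [] = done refl
    eval⇒reachable {_ ∷ P} ((a , b , a∈A , b∈A , d≈a-b) ∷ P∈) =
      eval⇒reachable P∈ ++
        edge a b a∈A b∈A (trans (+-congʳ d≈a-b) (sym (x+y-z≈y-z+x (β * eval P β) a b)))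

  reachable⇔eval : ∀ {β A x} → Path β A 0# x ⇔
                   (Σ (List Carrier) λ P → CoeffsIn A P × x ≈ eval P β)
  reachable⇔eval = mk⇔ (λ path → reachable⇒eval path [] refl)
    (λ (P , P∈ , x≈Pβ) → Path-resp refl (sym x≈Pβ) (eval⇒reachable P∈))

  reverse-scaled : ∀ {β γ A p r} → γ * β ≈ 1# → Path β A p r → Path γ A (β * r) (β * p)
  reverse-scaled γβ≈1 (done p≈r) = done (*-congˡ (sym p≈r))
  reverse-scaled {β} {γ} {p = p} γβ≈1 (step {q = q} g h g∈A h∈A q≈βp+g-h path) =
    reverse-scaled γβ≈1 path ++ edge h g h∈A g∈A (begin
      β * p                      ≈⟨ x+y-z+z-y≈x (β * p) g h ⟨
      β * p + g - h + h - g      ≈⟨ +-congʳ (+-congʳ q≈βp+g-h) ⟨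
      q + h - g                  ≈⟨ +-congʳ (+-congʳ (*-cancelˡ-inverse γβ≈1 q)) ⟨
      γ * (β * q) + h - g        ∎)

  coreachable⇔reachable-inverse : ∀ {β β⁻¹ A x} → β * β⁻¹ ≈ 1# →
    Path β A x 0# ⇔ Path β⁻¹ A 0# (β * x)
  coreachable⇔reachable-inverse {β} {β⁻¹} {x = x} ββ⁻¹≈1 = mk⇔
    (λ path → Path-resp (sym (zeroʳ β)) refl (reverse-scaled β⁻¹β≈1 path))
    (λ path → Path-resp (sym (*-cancelˡ-inverse β⁻¹β≈1 x)) (zeroʳ β⁻¹)
                (reverse-scaled ββ⁻¹≈1 path))
    where β⁻¹β≈1 = trans (*-comm β⁻¹ β) ββ⁻¹≈1

  *-shift-inverse : ∀ {β β⁻¹ x y} → β * β⁻¹ ≈ 1# → β * x ≈ y → x ≈ β⁻¹ * y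
  *-shift-inverse {β} {β⁻¹} {x} ββ⁻¹≈1 βx≈y =
    trans (sym (*-cancelˡ-inverse (trans (*-comm β⁻¹ β) ββ⁻¹≈1) x)) (*-congˡ βx≈y)

  *-unshift-inverse : ∀ {β β⁻¹ x y} → β * β⁻¹ ≈ 1# → x ≈ β⁻¹ * y → β * x ≈ y
  *-unshift-inverse {y = y} ββ⁻¹≈1 x≈β⁻¹y =
    trans (*-congˡ x≈β⁻¹y) (*-cancelˡ-inverse ββ⁻¹≈1 y)

mainTheorem6 : {c ℓ : Level} (K : Field c ℓ) →
    let open Field K in
    let open FieldAutomaton K in
    (β : Carrier) → ¬ (β ≈ 0#) →
    (β⁻¹ : Carrier) → β * β⁻¹ ≈ 1# →
    (A : List Carrier) → (x : Carrier) →
    TrimState β A x ⇔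
    (Σ (List Carrier) λ P → Σ (List Carrier) λ Q →
    CoeffsIn A P × CoeffsIn A Q × x ≈ eval P β × x ≈ β⁻¹ * eval Q β⁻¹)
mainTheorem6 K β _ β⁻¹ ββ⁻¹≈1 _ _ = mk⇔
  (λ (from0 , to0) →
    let P , P∈ , x≈Pβ = to reachable⇔eval from0
        Q , Q∈ , βx≈Qβ⁻¹ = to reachable⇔eval (to (coreachable⇔reachable-inverse ββ⁻¹≈1) to0)
    in P , Q , P∈ , Q∈ , x≈Pβ , *-shift-inverse ββ⁻¹≈1 βx≈Qβ⁻¹)
  (λ (P , Q , P∈ , Q∈ , x≈Pβ , x≈β⁻¹Qβ⁻¹) →
    from reachable⇔eval (P , P∈ , x≈Pβ) ,
    from (coreachable⇔reachable-inverse ββ⁻¹≈1) (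
      from reachable⇔eval (Q , Q∈ , *-unshift-inverse ββ⁻¹≈1 x≈β⁻¹Qβ⁻¹)))
  where
    open TrimStates K
    open Equivalence using (to; from)
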